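{- Let $n\ge1$ and let $d_1,\dots,d_n$ be positive square-free integers such that $F=\mathbb{Q}(\sqrt{d_1},\dots,\sqrt{d_n})$ satisfies $[F:\mathbb{Q}]=2^n$. Let $\mathfrak{M}$ be a nonzero fractional ideal of $F$, and let $S$ be the set of rational solutions $(x_0,x_1,\dots,x_n,(y_{i',j'})_{2\le i'\le n,\,1\le j'\le\binom{n}{i'}})$ of the Diophantine equation $$2^n\left(X_0^2+\sum_{i=1}^n d_iX_i^2+\sum_{i'=2}^n\sum_{j'=1}^{\binom{n}{i'}} Y_{i',j'}^2\prod_{\alpha=1}^{i'} d_{s_\alpha}\right)=(\min(\mathfrak{M}))^2.$$ Then the set of shortest nonzero lattice points of $\mathfrak{M}$ is exactly $$\left\{x_0+\sum_{i=1}^n x_i\sqrt{d_i}+\sum_{i'=2}^n\sum_{j'=1}^{\binom{n}{i'}} y_{i',j'}\prod_{\alpha=1}^{i'}\sqrt{d_{s_\alpha}}\in\mathfrak{M}\;:\;(x_0,\dots,x_n,(y_{i',j'}))\in S\right\}.$$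
   Context: Let $\sigma_1,\dots,\sigma_{2^n}$ be the distinct (real) embeddings of $F$ and $\|\sigma(s)\|=\sqrt{\sum_{i}\sigma_i(s)^2}$ for $s\in F$. For a nonzero fractional ideal $\mathfrak{M}$, $\min(\mathfrak{M})=\min\{\|\sigma(s)\|: s\in\mathfrak{M},\ s\ne0\}$, and the set of shortest nonzero lattice points of $\mathfrak{M}$ is $\{s\in\mathfrak{M}:\|\sigma(s)\|=\min(\mathfrak{M})\}$. Indexing convention: for each $i'\in\{2,\dots,n\}$, the index $j'\in\{1,\dots,\binom{n}{i'}\}$ runs bijectively over the $i'$-element subsets $\{s_1<\dots<s_{i'}\}$ of $\{1,\dots,n\}$, and in the term indexed by $(i',j')$ the symbols $s_1,\dots,s_{i'}$ denote the elements of that subset. -}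

module Defs where

open import Data.Nat as ℕ using (ℕ; zero; suc)
open import Data.Nat.Divisibility using (_∣_)
open import Data.Integer as ℤ using (ℤ)
open import Data.Rational as ℚ using (ℚ; 0ℚ; 1ℚ)
open import Data.Bool using (Bool; true; false; if_then_else_)
open import Data.Fin using (Fin; zero; suc)
open import Data.Vec using (Vec; []; _∷_; lookup)
open import Data.List using (List; []; _∷_; _++_; map; foldr; [_])
open import Data.Product using (_×_; _,_; Σ; ∃)
open import Relation.Binary.PropositionalEquality using (_≡_)
open import Relation.Nullary using (¬_)

ℕ→ℚ : ℕ → ℚ
ℕ→ℚ k = ℤ.+ k ℚ./ 1

-- The field F = ℚ(√d₁,…,√dₙ), built as the tower
--   F[]        = ℚ
--   F(d ∷ ds)  = F(ds)(√d) = { a + b √d : a, b ∈ F(ds) }   (pairs (a , b)).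
-- The head of the vector is the LAST adjoined square root; the index
-- i : Fin n refers to the i-th entry of the vector ds, i.e. to d_{i+1}.

F : ∀ {n} → Vec ℕ n → Set
F []       = ℚ
F (d ∷ ds) = F ds × F ds

zeroF : ∀ {n} (ds : Vec ℕ n) → F ds
zeroF []       = 0ℚ
zeroF (d ∷ ds) = zeroF ds , zeroF ds

embQ : ∀ {n} (ds : Vec ℕ n) → ℚ → F ds
embQ []       q = q
embQ (d ∷ ds) q = embQ ds q , zeroF ds

oneF : ∀ {n} (ds : Vec ℕ n) → F ds
oneF ds = embQ ds 1ℚ

addF : ∀ {n} (ds : Vec ℕ n) → F ds → F ds → F ds
addF []       p q             = p ℚ.+ q
addF (d ∷ ds) (a , b) (c , e) = addF ds a c , addF ds b e

negF : ∀ {n} (ds : Vec ℕ n) → F ds → F ds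
negF []       p       = ℚ.- p
negF (d ∷ ds) (a , b) = negF ds a , negF ds b

-- (a + b√d)(c + e√d) = (ac + d·be) + (ae + bc)√d
mulF : ∀ {n} (ds : Vec ℕ n) → F ds → F ds → F ds
mulF []       p q             = p ℚ.* q
mulF (d ∷ ds) (a , b) (c , e) =
  addF ds (mulF ds a c) (mulF ds (embQ ds (ℕ→ℚ d)) (mulF ds b e)) ,
  addF ds (mulF ds a e) (mulF ds b c)

powF : ∀ {n} (ds : Vec ℕ n) → F ds → ℕ → F ds
powF ds s zero    = oneF ds
powF ds s (suc k) = mulF ds s (powF ds s k)

sumF : ∀ {n} (ds : Vec ℕ n) → List (F ds) → F ds
sumF ds = foldr (addF ds) (zeroF ds)

prodF : ∀ {n} (ds : Vec ℕ n) → List (F ds) → F ds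
prodF ds = foldr (mulF ds) (oneF ds)

sqrtD : ∀ {n} (ds : Vec ℕ n) → Fin n → F ds
sqrtD (d ∷ ds) zero    = zeroF ds , oneF ds
sqrtD (d ∷ ds) (suc i) = sqrtD ds i , zeroF ds

constF : ∀ {n} (ds : Vec ℕ n) → F ds → ℚ
constF []       q       = q
constF (d ∷ ds) (a , b) = constF ds a

-- Subsets of {1,…,n} as characteristic vectors, and their enumeration.

allFins : ∀ n → List (Fin n)
allFins zero    = []
allFins (suc n) = zero ∷ map suc (allFins n)

allVecBool : ∀ n → List (Vec Bool n)
allVecBool zero    = [ [] ]
allVecBool (suc n) = map (false ∷_) (allVecBool n) ++ map (true ∷_) (allVecBool n)

monomial : ∀ {n} (ds : Vec ℕ n) → Vec Bool n → F ds
monomial {n} ds T =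
  prodF ds (map (λ i → if lookup T i then sqrtD ds i else oneF ds) (allFins n))

dProd : ∀ {n} (ds : Vec ℕ n) → Vec Bool n → ℕ
dProd {n} ds T = foldr ℕ._*_ 1 (map (λ i → if lookup T i then lookup ds i else 1) (allFins n))

sumℚ : List ℚ → ℚ
sumℚ = foldr ℚ._+_ 0ℚ

fromCoords : ∀ {n} (ds : Vec ℕ n) → (Vec Bool n → ℚ) → F ds
fromCoords {n} ds x = sumF ds (map (λ T → mulF ds (embQ ds (x T)) (monomial ds T)) (allVecBool n))

-- Left-hand side of the Diophantine equation:
-- 2^n ( Σ_T  x_T² ∏_{i∈T} d_i )   (T = ∅ gives X₀², |T| = 1 gives d_i X_i²,
--                                   |T| ≥ 2 gives the Y_{i',j'}-terms)
dioLHS : ∀ {n} (ds : Vec ℕ n) → (Vec Bool n → ℚ) → ℚ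
dioLHS {n} ds x =
  ℕ→ℚ (2 ℕ.^ n) ℚ.* sumℚ (map (λ T → (x T ℚ.* x T) ℚ.* ℕ→ℚ (dProd ds T)) (allVecBool n))

-- The automorphism σ_ε (ε ∈ {±}^n, encoded as Vec Bool n,
-- false = sign change) sends √d_i ↦ ±√d_i.  Fixing the real embedding ι
-- with ι(√d_i) = +√d_i > 0, the 2^n real embeddings are ι ∘ σ_ε, so
--   ‖σ(s)‖² = Σ_ε ι(σ_ε(s))² = ι(Σ_ε σ_ε(s)²),
-- and Σ_ε σ_ε(s)² is Galois invariant, i.e. rational, i.e. equal to its
-- constant coordinate.

conjF : ∀ {n} (ds : Vec ℕ n) → Vec Bool n → F ds → F ds
conjF []       []          q       = q
conjF (d ∷ ds) (true  ∷ ε) (a , b) = conjF ds ε a , conjF ds ε b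
conjF (d ∷ ds) (false ∷ ε) (a , b) = conjF ds ε a , negF ds (conjF ds ε b)

normSq : ∀ {n} (ds : Vec ℕ n) → F ds → ℚ
normSq {n} ds s =
  constF ds (sumF ds (map (λ ε → let t = conjF ds ε s in mulF ds t t) (allVecBool n)))

SquareFree : ℕ → Set
SquareFree d = ∀ p → p ℕ.* p ∣ d → p ≡ 1

-- [F : ℚ] = 2^n  ⇔  the 2^n-dimensional ℚ-algebra F above is a field.
IsFieldF : ∀ {n} (ds : Vec ℕ n) → Set
IsFieldF ds = ∀ s → ¬ s ≡ zeroF ds → ∃ λ t → mulF ds s t ≡ oneF ds

polyTail : ∀ {n} (ds : Vec ℕ n) → F ds → ∀ {k} → Vec ℤ k → F ds
polyTail ds s []      = zeroF ds
polyTail ds s (c ∷ cs) = addF ds (embQ ds (c ℚ./ 1)) (mulF ds s (polyTail ds s cs))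

IsIntegral : ∀ {n} (ds : Vec ℕ n) → F ds → Set
IsIntegral ds s = Σ ℕ λ k → Σ (Vec ℤ k) λ cs →
  addF ds (powF ds s k) (polyTail ds s cs) ≡ zeroF ds

record IsNonzeroFracIdeal {n} (ds : Vec ℕ n) (M : F ds → Set) : Set where
  field
    zero∈   : M (zeroF ds)
    add∈    : ∀ {s t} → M s → M t → M (addF ds s t)
    smul∈   : ∀ {r s} → IsIntegral ds r → M s → M (mulF ds r s)
    nonzero : ∃ λ s → M s × ¬ s ≡ zeroF ds
    denom   : ∃ λ c → IsIntegral ds c × ¬ c ≡ zeroF ds ×
                (∀ {s} → M s → IsIntegral ds (mulF ds c s))

-- m = min(M)²
IsMinSq : ∀ {n} (ds : Vec ℕ n) → (F ds → Set) → ℚ → Set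
IsMinSq ds M m =
  (∃ λ s → M s × ¬ s ≡ zeroF ds × normSq ds s ≡ m) ×
  (∀ t → M t → ¬ t ≡ zeroF ds → m ℚ.≤ normSq ds t)

Shortest : ∀ {n} (ds : Vec ℕ n) → (F ds → Set) → ℚ → F ds → Set
Shortest ds M m s = M s × ¬ s ≡ zeroF ds × normSq ds s ≡ m

{-# OPTIONS --safe #-}
-- Write s = a + b√d over the previous field of the tower.  Each conjugate of s is a ± b√d, and
-- the constant coordinate of (a ± b√d)² is a² + d b² for either sign, so summing over the 2ⁿ
-- conjugates gives ‖σ(s)‖² = 2ⁿ Σ_T x_T² ∏_{i∈T} d_i, where x are the coordinates of s in the
-- monomial basis.  Hence the shortest points of M are exactly the points of M whose coordinates
-- solve the equation; such a point is nonzero because the form is positive definite (all d_i > 0)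
-- while min(M) > 0.
module Submission where

open import Defs
open import Algebra.Structures using (IsMonoid)
open import Data.Bool using (Bool; true; false; if_then_else_)
open import Data.Bool.Properties using (if-float)
open import Data.Empty using (⊥-elim)
open import Data.Fin using (Fin; zero; suc)
open import Data.List using (List; []; _∷_; _++_; map; foldr)
import Data.List.Properties as ListP
open import Data.Nat using (ℕ; _≤_; _<_)
import Data.Nat as ℕ
import Data.Nat.Properties as ℕP
import Data.Nat.Coprimality as Coprimality
import Data.Integer as ℤ
import Data.Integer.Properties as ℤP
open import Data.Rational using (ℚ; 0ℚ; mkℚ; Positive; NonNegative)
import Data.Rational as ℚ
import Data.Rational.Properties as ℚP
open import Data.Rational.Solver using (module +-*-Solver)
open import Data.Product using (_×_; ∃; _,_)
open import Data.Sum using (_⊎_; inj₁; inj₂)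
open import Data.Vec using (Vec; []; _∷_; lookup)
open import Data.Vec.Relation.Unary.All using (All; []; _∷_)
open import Function using (_∘_)
open import Relation.Binary using (tri<; tri≈; tri>)
open import Relation.Binary.PropositionalEquality
open import Relation.Nullary using (¬_)

open +-*-Solver using (solve; _:+_; _:*_; :-_; _:=_)

ℕ→ℚ≡mkℚ : ∀ k → ℕ→ℚ k ≡ mkℚ (ℤ.+ k) 0 (Coprimality.sym (Coprimality.1-coprimeTo k))
ℕ→ℚ≡mkℚ k = ℚP.normalize-coprime (Coprimality.sym (Coprimality.1-coprimeTo k))

ℕ→ℚ-homo-+ : ∀ j k → ℕ→ℚ (j ℕ.+ k) ≡ ℕ→ℚ j ℚ.+ ℕ→ℚ k
ℕ→ℚ-homo-+ j k rewrite ℕ→ℚ≡mkℚ j | ℕ→ℚ≡mkℚ k =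
  cong (ℚ._/ 1) (trans (ℤP.pos-+ j k)
    (sym (cong₂ ℤ._+_ (ℤP.*-identityʳ (ℤ.+ j)) (ℤP.*-identityʳ (ℤ.+ k)))))

ℕ→ℚ-homo-* : ∀ j k → ℕ→ℚ (j ℕ.* k) ≡ ℕ→ℚ j ℚ.* ℕ→ℚ k
ℕ→ℚ-homo-* j k rewrite ℕ→ℚ≡mkℚ j | ℕ→ℚ≡mkℚ k = cong (ℚ._/ 1) (ℤP.pos-* j k)

ℕ→ℚ-pos : ∀ k → 0 < k → Positive (ℕ→ℚ k)
ℕ→ℚ-pos (ℕ.suc k) _ = ℚP.normalize-pos (ℕ.suc k) 1

ℕ→ℚ-2^suc : ∀ n → ℕ→ℚ (2 ℕ.^ ℕ.suc n) ≡ ℕ→ℚ (2 ℕ.^ n) ℚ.+ ℕ→ℚ (2 ℕ.^ n)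
ℕ→ℚ-2^suc n =
  trans (cong (λ k → ℕ→ℚ (2 ℕ.^ n ℕ.+ k)) (ℕP.+-identityʳ (2 ℕ.^ n)))
        (ℕ→ℚ-homo-+ (2 ℕ.^ n) (2 ℕ.^ n))

module MonoidSum {A : Set} {_∙_ : A → A → A} {ε : A} (isMonoid : IsMonoid _≡_ _∙_ ε) where
  open IsMonoid isMonoid using (assoc; identityˡ)

  sumOf : {B : Set} → (B → A) → List B → A
  sumOf f bs = foldr _∙_ ε (map f bs)

  sumOf-cong : ∀ {B : Set} {f g : B → A} → (∀ b → f b ≡ g b) → ∀ bs → sumOf f bs ≡ sumOf g bs
  sumOf-cong f≗g bs = cong (foldr _∙_ ε) (ListP.map-cong f≗g bs)

  sumOf-map : ∀ {B C : Set} (f : C → A) (g : B → C) bs → sumOf f (map g bs) ≡ sumOf (f ∘ g) bs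
  sumOf-map f g bs = cong (foldr _∙_ ε) (sym (ListP.map-∘ bs))

  sumOf-++ : ∀ {B : Set} (f : B → A) bs cs → sumOf f (bs ++ cs) ≡ sumOf f bs ∙ sumOf f cs
  sumOf-++ f []       cs = sym (identityˡ _)
  sumOf-++ f (b ∷ bs) cs = trans (cong (f b ∙_) (sumOf-++ f bs cs)) (sym (assoc _ _ _))

  sumOf-allVecBool-suc : ∀ {n} (f : Vec Bool (ℕ.suc n) → A) →
    sumOf f (allVecBool (ℕ.suc n)) ≡
    sumOf (f ∘ (false ∷_)) (allVecBool n) ∙ sumOf (f ∘ (true ∷_)) (allVecBool n)
  sumOf-allVecBool-suc {n} f =
    trans (sumOf-++ f (map (false ∷_) vs) (map (true ∷_) vs))
          (cong₂ _∙_ (sumOf-map f (false ∷_) vs) (sumOf-map f (true ∷_) vs))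
    where vs = allVecBool n

module ℚΣ = MonoidSum ℚP.+-0-isMonoid
open ℚΣ using (sumOf-cong; sumOf-allVecBool-suc)

sumOf-scale : ∀ {B : Set} (c : ℚ) (f : B → ℚ) bs →
  ℚΣ.sumOf (λ b → c ℚ.* f b) bs ≡ c ℚ.* ℚΣ.sumOf f bs
sumOf-scale c f []       = sym (ℚP.*-zeroʳ c)
sumOf-scale c f (b ∷ bs) =
  trans (cong (c ℚ.* f b ℚ.+_) (sumOf-scale c f bs)) (sym (ℚP.*-distribˡ-+ c (f b) _))

sumOf-linear : ∀ {B : Set} (c : ℚ) (f g : B → ℚ) bs →
  ℚΣ.sumOf (λ b → f b ℚ.+ c ℚ.* g b) bs ≡ ℚΣ.sumOf f bs ℚ.+ c ℚ.* ℚΣ.sumOf g bs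
sumOf-linear c f g []       = sym (trans (ℚP.+-identityˡ _) (ℚP.*-zeroʳ c))
sumOf-linear c f g (b ∷ bs) rewrite sumOf-linear c f g bs =
  solve 5 (λ F G ΣF ΣG C → (F :+ C :* G) :+ (ΣF :+ C :* ΣG) := (F :+ ΣF) :+ C :* (G :+ ΣG))
    refl (f b) (g b) (ℚΣ.sumOf f bs) (ℚΣ.sumOf g bs) c

addF-identityˡ : ∀ {n} (ds : Vec ℕ n) s → addF ds (zeroF ds) s ≡ s
addF-identityˡ []       q       = ℚP.+-identityˡ q
addF-identityˡ (d ∷ ds) (a , b) = cong₂ _,_ (addF-identityˡ ds a) (addF-identityˡ ds b)

addF-identityʳ : ∀ {n} (ds : Vec ℕ n) s → addF ds s (zeroF ds) ≡ s
addF-identityʳ []       q       = ℚP.+-identityʳ q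
addF-identityʳ (d ∷ ds) (a , b) = cong₂ _,_ (addF-identityʳ ds a) (addF-identityʳ ds b)

addF-assoc : ∀ {n} (ds : Vec ℕ n) s t u → addF ds (addF ds s t) u ≡ addF ds s (addF ds t u)
addF-assoc []       p       q       r       = ℚP.+-assoc p q r
addF-assoc (d ∷ ds) (a , b) (c , e) (f , g) = cong₂ _,_ (addF-assoc ds a c f) (addF-assoc ds b e g)

addF-isMonoid : ∀ {n} (ds : Vec ℕ n) → IsMonoid _≡_ (addF ds) (zeroF ds)
addF-isMonoid ds = record
  { isSemigroup = record
    { isMagma = record { isEquivalence = isEquivalence ; ∙-cong = cong₂ (addF ds) }
    ; assoc   = addF-assoc ds
    }
  ; identity = addF-identityˡ ds , addF-identityʳ ds
  }

module FΣ {n} (ds : Vec ℕ n) = MonoidSum (addF-isMonoid ds)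

mulF-zeroʳ : ∀ {n} (ds : Vec ℕ n) s → mulF ds s (zeroF ds) ≡ zeroF ds
mulF-zeroʳ []       q = ℚP.*-zeroʳ q
mulF-zeroʳ (d ∷ ds) (a , b)
  rewrite mulF-zeroʳ ds a | mulF-zeroʳ ds b | mulF-zeroʳ ds (embQ ds (ℕ→ℚ d))
        | addF-identityˡ ds (zeroF ds) = refl

mulF-zeroˡ : ∀ {n} (ds : Vec ℕ n) s → mulF ds (zeroF ds) s ≡ zeroF ds
mulF-zeroˡ []       q = ℚP.*-zeroˡ q
mulF-zeroˡ (d ∷ ds) (a , b)
  rewrite mulF-zeroˡ ds a | mulF-zeroˡ ds b | mulF-zeroʳ ds (embQ ds (ℕ→ℚ d))
        | addF-identityˡ ds (zeroF ds) = refl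

mulF-identityˡ : ∀ {n} (ds : Vec ℕ n) s → mulF ds (oneF ds) s ≡ s
mulF-identityˡ []       q = ℚP.*-identityˡ q
mulF-identityˡ (d ∷ ds) (a , b)
  rewrite mulF-identityˡ ds a | mulF-identityˡ ds b | mulF-zeroˡ ds a | mulF-zeroˡ ds b
        | mulF-zeroʳ ds (embQ ds (ℕ→ℚ d)) | addF-identityʳ ds a | addF-identityʳ ds b = refl

mulF-negF : ∀ {n} (ds : Vec ℕ n) s t → mulF ds (negF ds s) (negF ds t) ≡ mulF ds s t
mulF-negF []       p       q       = solve 2 (λ p q → (:- p) :* (:- q) := p :* q) refl p q
mulF-negF (d ∷ ds) (a , b) (c , e)
  rewrite mulF-negF ds a c | mulF-negF ds b e | mulF-negF ds a e | mulF-negF ds b c = refl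

embQ-mulF : ∀ {n} d (ds : Vec ℕ n) q a b →
  mulF (d ∷ ds) (embQ (d ∷ ds) q) (a , b) ≡ (mulF ds (embQ ds q) a , mulF ds (embQ ds q) b)
embQ-mulF d ds q a b
  rewrite mulF-zeroˡ ds a | mulF-zeroˡ ds b | mulF-zeroʳ ds (embQ ds (ℕ→ℚ d))
        | addF-identityʳ ds (mulF ds (embQ ds q) a)
        | addF-identityʳ ds (mulF ds (embQ ds q) b) = refl

mulF-lift : ∀ {n} d (ds : Vec ℕ n) a b →
  mulF (d ∷ ds) (a , zeroF ds) (b , zeroF ds) ≡ (mulF ds a b , zeroF ds)
mulF-lift d ds a b
  rewrite mulF-zeroˡ ds (zeroF ds) | mulF-zeroʳ ds (embQ ds (ℕ→ℚ d)) | mulF-zeroʳ ds a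
        | mulF-zeroˡ ds b | addF-identityʳ ds (mulF ds a b) | addF-identityˡ ds (zeroF ds) = refl

sqrtD-zero-mulF-lift : ∀ {n} d (ds : Vec ℕ n) a →
  mulF (d ∷ ds) (sqrtD (d ∷ ds) zero) (a , zeroF ds) ≡ (zeroF ds , a)
sqrtD-zero-mulF-lift d ds a
  rewrite mulF-zeroˡ ds a | mulF-zeroʳ ds (oneF ds) | mulF-zeroʳ ds (embQ ds (ℕ→ℚ d))
        | mulF-zeroˡ ds (zeroF ds) | mulF-identityˡ ds a | addF-identityˡ ds (zeroF ds)
        | addF-identityˡ ds a = refl

constF-addF : ∀ {n} (ds : Vec ℕ n) s t → constF ds (addF ds s t) ≡ constF ds s ℚ.+ constF ds t
constF-addF []       p       q       = refl
constF-addF (d ∷ ds) (a , b) (c , e) = constF-addF ds a c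

constF-zeroF : ∀ {n} (ds : Vec ℕ n) → constF ds (zeroF ds) ≡ 0ℚ
constF-zeroF []       = refl
constF-zeroF (d ∷ ds) = constF-zeroF ds

constF-embQ-mulF : ∀ {n} (ds : Vec ℕ n) q s → constF ds (mulF ds (embQ ds q) s) ≡ q ℚ.* constF ds s
constF-embQ-mulF []       q p       = refl
constF-embQ-mulF (d ∷ ds) q (a , b) =
  trans (cong (constF (d ∷ ds)) (embQ-mulF d ds q a b)) (constF-embQ-mulF ds q a)

constF-sumOf : ∀ {n} (ds : Vec ℕ n) {B : Set} (f : B → F ds) bs →
  constF ds (FΣ.sumOf ds f bs) ≡ ℚΣ.sumOf (constF ds ∘ f) bs
constF-sumOf ds f []       = constF-zeroF ds
constF-sumOf ds f (b ∷ bs) =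
  trans (constF-addF ds (f b) _) (cong (constF ds (f b) ℚ.+_) (constF-sumOf ds f bs))

prodF-lift : ∀ {n} d (ds : Vec ℕ n) (g : Fin n → F ds) (h : Fin (ℕ.suc n) → F (d ∷ ds)) →
  (∀ i → h (suc i) ≡ (g i , zeroF ds)) →
  ∀ is → prodF (d ∷ ds) (map h (map suc is)) ≡ (prodF ds (map g is) , zeroF ds)
prodF-lift d ds g h h≡g []       = refl
prodF-lift d ds g h h≡g (i ∷ is) =
  trans (cong₂ (mulF (d ∷ ds)) (h≡g i) (prodF-lift d ds g h h≡g is)) (mulF-lift d ds (g i) _)

monomialFactor : ∀ {n} (ds : Vec ℕ n) → Vec Bool n → Fin n → F ds
monomialFactor ds T i = if lookup T i then sqrtD ds i else oneF ds

monomialFactor-suc : ∀ {n} d (ds : Vec ℕ n) b T i →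
  monomialFactor (d ∷ ds) (b ∷ T) (suc i) ≡ (monomialFactor ds T i , zeroF ds)
monomialFactor-suc d ds b T i = sym (if-float (_, zeroF ds) (lookup T i))

monomial-false : ∀ {n} d (ds : Vec ℕ n) T →
  monomial (d ∷ ds) (false ∷ T) ≡ (monomial ds T , zeroF ds)
monomial-false {n} d ds T =
  trans (mulF-identityˡ (d ∷ ds) _)
        (prodF-lift d ds _ _ (monomialFactor-suc d ds false T) (allFins n))

monomial-true : ∀ {n} d (ds : Vec ℕ n) T →
  monomial (d ∷ ds) (true ∷ T) ≡ (zeroF ds , monomial ds T)
monomial-true {n} d ds T =
  trans (cong (mulF (d ∷ ds) (sqrtD (d ∷ ds) zero))
              (prodF-lift d ds _ _ (monomialFactor-suc d ds true T) (allFins n)))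
        (sqrtD-zero-mulF-lift d ds (monomial ds T))

coordTerm : ∀ {n} (ds : Vec ℕ n) → (Vec Bool n → ℚ) → Vec Bool n → F ds
coordTerm ds x T = mulF ds (embQ ds (x T)) (monomial ds T)

coordTerm-false : ∀ {n} d (ds : Vec ℕ n) x T →
  coordTerm (d ∷ ds) x (false ∷ T) ≡ (coordTerm ds (x ∘ (false ∷_)) T , zeroF ds)
coordTerm-false d ds x T = begin
  mulF (d ∷ ds) (embQ (d ∷ ds) q) (monomial (d ∷ ds) (false ∷ T))
    ≡⟨ cong (mulF (d ∷ ds) (embQ (d ∷ ds) q)) (monomial-false d ds T) ⟩
  mulF (d ∷ ds) (embQ (d ∷ ds) q) (monomial ds T , zeroF ds)
    ≡⟨ embQ-mulF d ds q (monomial ds T) (zeroF ds) ⟩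
  (mulF ds (embQ ds q) (monomial ds T) , mulF ds (embQ ds q) (zeroF ds))
    ≡⟨ cong (mulF ds (embQ ds q) (monomial ds T) ,_) (mulF-zeroʳ ds (embQ ds q)) ⟩
  (mulF ds (embQ ds q) (monomial ds T) , zeroF ds) ∎
  where open ≡-Reasoning
        q = x (false ∷ T)

coordTerm-true : ∀ {n} d (ds : Vec ℕ n) x T →
  coordTerm (d ∷ ds) x (true ∷ T) ≡ (zeroF ds , coordTerm ds (x ∘ (true ∷_)) T)
coordTerm-true d ds x T = begin
  mulF (d ∷ ds) (embQ (d ∷ ds) q) (monomial (d ∷ ds) (true ∷ T))
    ≡⟨ cong (mulF (d ∷ ds) (embQ (d ∷ ds) q)) (monomial-true d ds T) ⟩
  mulF (d ∷ ds) (embQ (d ∷ ds) q) (zeroF ds , monomial ds T)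
    ≡⟨ embQ-mulF d ds q (zeroF ds) (monomial ds T) ⟩
  (mulF ds (embQ ds q) (zeroF ds) , mulF ds (embQ ds q) (monomial ds T))
    ≡⟨ cong (_, mulF ds (embQ ds q) (monomial ds T)) (mulF-zeroʳ ds (embQ ds q)) ⟩
  (zeroF ds , mulF ds (embQ ds q) (monomial ds T)) ∎
  where open ≡-Reasoning
        q = x (true ∷ T)

sumOf-lift₁ : ∀ {n} d (ds : Vec ℕ n) {B : Set} {g : B → F ds} {h : B → F (d ∷ ds)} →
  (∀ b → h b ≡ (g b , zeroF ds)) →
  ∀ bs → FΣ.sumOf (d ∷ ds) h bs ≡ (FΣ.sumOf ds g bs , zeroF ds)
sumOf-lift₁ d ds h≡g []       = refl
sumOf-lift₁ d ds h≡g (b ∷ bs)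
  rewrite h≡g b | sumOf-lift₁ d ds h≡g bs | addF-identityˡ ds (zeroF ds) = refl

sumOf-lift₂ : ∀ {n} d (ds : Vec ℕ n) {B : Set} {g : B → F ds} {h : B → F (d ∷ ds)} →
  (∀ b → h b ≡ (zeroF ds , g b)) →
  ∀ bs → FΣ.sumOf (d ∷ ds) h bs ≡ (zeroF ds , FΣ.sumOf ds g bs)
sumOf-lift₂ d ds h≡g []       = refl
sumOf-lift₂ d ds h≡g (b ∷ bs)
  rewrite h≡g b | sumOf-lift₂ d ds h≡g bs | addF-identityˡ ds (zeroF ds) = refl

fromCoords-[] : (x : Vec Bool 0 → ℚ) → fromCoords [] x ≡ x []
fromCoords-[] x = trans (ℚP.+-identityʳ _) (ℚP.*-identityʳ (x []))

fromCoords-∷ : ∀ {n} d (ds : Vec ℕ n) x →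
  fromCoords (d ∷ ds) x ≡ (fromCoords ds (x ∘ (false ∷_)) , fromCoords ds (x ∘ (true ∷_)))
fromCoords-∷ {n} d ds x = begin
  fromCoords (d ∷ ds) x
    ≡⟨ FΣ.sumOf-allVecBool-suc (d ∷ ds) (coordTerm (d ∷ ds) x) ⟩
  addF (d ∷ ds) (FΣ.sumOf (d ∷ ds) (coordTerm (d ∷ ds) x ∘ (false ∷_)) vs)
                (FΣ.sumOf (d ∷ ds) (coordTerm (d ∷ ds) x ∘ (true ∷_)) vs)
    ≡⟨ cong₂ (addF (d ∷ ds)) (sumOf-lift₁ d ds (coordTerm-false d ds x) vs)
                             (sumOf-lift₂ d ds (coordTerm-true d ds x) vs) ⟩
  (addF ds (fromCoords ds (x ∘ (false ∷_))) (zeroF ds) ,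
   addF ds (zeroF ds) (fromCoords ds (x ∘ (true ∷_))))
    ≡⟨ cong₂ _,_ (addF-identityʳ ds _) (addF-identityˡ ds _) ⟩
  (fromCoords ds (x ∘ (false ∷_)) , fromCoords ds (x ∘ (true ∷_))) ∎
  where open ≡-Reasoning
        vs = allVecBool n

coords : ∀ {n} (ds : Vec ℕ n) → F ds → Vec Bool n → ℚ
coords []       q       []          = q
coords (d ∷ ds) (a , b) (false ∷ T) = coords ds a T
coords (d ∷ ds) (a , b) (true  ∷ T) = coords ds b T

fromCoords-coords : ∀ {n} (ds : Vec ℕ n) s → fromCoords ds (coords ds s) ≡ s
fromCoords-coords []       q       = fromCoords-[] (coords [] q)
fromCoords-coords (d ∷ ds) (a , b) =
  trans (fromCoords-∷ d ds (coords (d ∷ ds) (a , b)))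
        (cong₂ _,_ (fromCoords-coords ds a) (fromCoords-coords ds b))

quadForm : ∀ {n} (ds : Vec ℕ n) → F ds → ℚ
quadForm []       q       = q ℚ.* q
quadForm (d ∷ ds) (a , b) = quadForm ds a ℚ.+ ℕ→ℚ d ℚ.* quadForm ds b

dProd-false : ∀ {n} d (ds : Vec ℕ n) T → dProd (d ∷ ds) (false ∷ T) ≡ dProd ds T
dProd-false {n} d ds T =
  trans (ℕP.*-identityˡ _) (cong (foldr ℕ._*_ 1) (sym (ListP.map-∘ (allFins n))))

dProd-true : ∀ {n} d (ds : Vec ℕ n) T → dProd (d ∷ ds) (true ∷ T) ≡ d ℕ.* dProd ds T
dProd-true {n} d ds T = cong (d ℕ.*_) (cong (foldr ℕ._*_ 1) (sym (ListP.map-∘ (allFins n))))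

weightedSquares : ∀ {n} (ds : Vec ℕ n) → (Vec Bool n → ℚ) → ℚ
weightedSquares {n} ds x = ℚΣ.sumOf (λ T → (x T ℚ.* x T) ℚ.* ℕ→ℚ (dProd ds T)) (allVecBool n)

weightedSquares-∷ : ∀ {n} d (ds : Vec ℕ n) x →
  weightedSquares (d ∷ ds) x ≡
  weightedSquares ds (x ∘ (false ∷_)) ℚ.+ ℕ→ℚ d ℚ.* weightedSquares ds (x ∘ (true ∷_))
weightedSquares-∷ {n} d ds x =
  trans (sumOf-allVecBool-suc {n} (λ T → (x T ℚ.* x T) ℚ.* ℕ→ℚ (dProd (d ∷ ds) T)))
        (cong₂ ℚ._+_ (sumOf-cong false-term vs)
                     (trans (sumOf-cong true-term vs) (sumOf-scale (ℕ→ℚ d) _ vs)))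
  where
  vs = allVecBool n
  false-term : ∀ T → (x (false ∷ T) ℚ.* x (false ∷ T)) ℚ.* ℕ→ℚ (dProd (d ∷ ds) (false ∷ T))
                   ≡ (x (false ∷ T) ℚ.* x (false ∷ T)) ℚ.* ℕ→ℚ (dProd ds T)
  false-term T = cong (λ k → (x (false ∷ T) ℚ.* x (false ∷ T)) ℚ.* ℕ→ℚ k) (dProd-false d ds T)
  true-term : ∀ T → (x (true ∷ T) ℚ.* x (true ∷ T)) ℚ.* ℕ→ℚ (dProd (d ∷ ds) (true ∷ T))
                  ≡ ℕ→ℚ d ℚ.* ((x (true ∷ T) ℚ.* x (true ∷ T)) ℚ.* ℕ→ℚ (dProd ds T))
  true-term T rewrite dProd-true d ds T | ℕ→ℚ-homo-* d (dProd ds T) =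
    solve 3 (λ y D P → (y :* y) :* (D :* P) := D :* ((y :* y) :* P))
      refl (x (true ∷ T)) (ℕ→ℚ d) (ℕ→ℚ (dProd ds T))

weightedSquares≡quadForm : ∀ {n} (ds : Vec ℕ n) x →
  weightedSquares ds x ≡ quadForm ds (fromCoords ds x)
weightedSquares≡quadForm []       x rewrite fromCoords-[] x =
  trans (ℚP.+-identityʳ _) (ℚP.*-identityʳ _)
weightedSquares≡quadForm (d ∷ ds) x = begin
  weightedSquares (d ∷ ds) x
    ≡⟨ weightedSquares-∷ d ds x ⟩
  weightedSquares ds (x ∘ (false ∷_)) ℚ.+ ℕ→ℚ d ℚ.* weightedSquares ds (x ∘ (true ∷_))
    ≡⟨ cong₂ (λ u v → u ℚ.+ ℕ→ℚ d ℚ.* v) (weightedSquares≡quadForm ds _)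
                                         (weightedSquares≡quadForm ds _) ⟩
  quadForm (d ∷ ds) (fromCoords ds (x ∘ (false ∷_)) , fromCoords ds (x ∘ (true ∷_)))
    ≡⟨ cong (quadForm (d ∷ ds)) (fromCoords-∷ d ds x) ⟨
  quadForm (d ∷ ds) (fromCoords (d ∷ ds) x) ∎
  where open ≡-Reasoning

squareF : ∀ {n} (ds : Vec ℕ n) → F ds → F ds
squareF ds s = mulF ds s s

constF-squareF : ∀ {n} d (ds : Vec ℕ n) a b →
  constF (d ∷ ds) (squareF (d ∷ ds) (a , b)) ≡
  constF ds (squareF ds a) ℚ.+ ℕ→ℚ d ℚ.* constF ds (squareF ds b)
constF-squareF d ds a b =
  trans (constF-addF ds _ _) (cong (constF ds (squareF ds a) ℚ.+_) (constF-embQ-mulF ds (ℕ→ℚ d) _))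

conjSquares : ∀ {n} (ds : Vec ℕ n) → F ds → ℚ
conjSquares {n} ds s = ℚΣ.sumOf (λ ε → constF ds (squareF ds (conjF ds ε s))) (allVecBool n)

normSq≡conjSquares : ∀ {n} (ds : Vec ℕ n) s → normSq ds s ≡ conjSquares ds s
normSq≡conjSquares {n} ds s = constF-sumOf ds (λ ε → squareF ds (conjF ds ε s)) (allVecBool n)

conjSquares-∷ : ∀ {n} d (ds : Vec ℕ n) a b →
  conjSquares (d ∷ ds) (a , b) ≡
  (conjSquares ds a ℚ.+ ℕ→ℚ d ℚ.* conjSquares ds b) ℚ.+
  (conjSquares ds a ℚ.+ ℕ→ℚ d ℚ.* conjSquares ds b)
conjSquares-∷ {n} d ds a b =
  trans (sumOf-allVecBool-suc {n} (λ ε → constF (d ∷ ds) (squareF (d ∷ ds) (conjF (d ∷ ds) ε s))))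
    (cong₂ ℚ._+_
      (trans (sumOf-cong negated-term vs) (sumOf-linear (ℕ→ℚ d) _ _ vs))
      (trans (sumOf-cong (λ ε → constF-squareF d ds _ _) vs) (sumOf-linear (ℕ→ℚ d) _ _ vs)))
  where
  s = (a , b)
  vs = allVecBool n
  negated-term : ∀ ε →
    constF (d ∷ ds) (squareF (d ∷ ds) (conjF ds ε a , negF ds (conjF ds ε b))) ≡
    constF ds (squareF ds (conjF ds ε a)) ℚ.+ ℕ→ℚ d ℚ.* constF ds (squareF ds (conjF ds ε b))
  negated-term ε =
    trans (constF-squareF d ds _ _)
          (cong (λ t → constF ds (squareF ds (conjF ds ε a)) ℚ.+ ℕ→ℚ d ℚ.* constF ds t)
                (mulF-negF ds (conjF ds ε b) (conjF ds ε b)))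

conjSquares≡2ⁿ*quadForm : ∀ {n} (ds : Vec ℕ n) s →
  conjSquares ds s ≡ ℕ→ℚ (2 ℕ.^ n) ℚ.* quadForm ds s
conjSquares≡2ⁿ*quadForm []       q =
  trans (ℚP.+-identityʳ (q ℚ.* q)) (sym (ℚP.*-identityˡ (q ℚ.* q)))
conjSquares≡2ⁿ*quadForm {ℕ.suc n} (d ∷ ds) (a , b)
  rewrite conjSquares-∷ d ds a b | conjSquares≡2ⁿ*quadForm ds a | conjSquares≡2ⁿ*quadForm ds b
        | ℕ→ℚ-2^suc n =
  solve 4 (λ c D A B → (c :* A :+ D :* (c :* B)) :+ (c :* A :+ D :* (c :* B))
                    := (c :+ c) :* (A :+ D :* B))
    refl (ℕ→ℚ (2 ℕ.^ n)) (ℕ→ℚ d) (quadForm ds a) (quadForm ds b)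

normSq≡2ⁿ*quadForm : ∀ {n} (ds : Vec ℕ n) s → normSq ds s ≡ ℕ→ℚ (2 ℕ.^ n) ℚ.* quadForm ds s
normSq≡2ⁿ*quadForm ds s = trans (normSq≡conjSquares ds s) (conjSquares≡2ⁿ*quadForm ds s)

normSq-fromCoords : ∀ {n} (ds : Vec ℕ n) x → normSq ds (fromCoords ds x) ≡ dioLHS ds x
normSq-fromCoords {n} ds x =
  trans (normSq≡2ⁿ*quadForm ds (fromCoords ds x))
        (cong (ℕ→ℚ (2 ℕ.^ n) ℚ.*_) (sym (weightedSquares≡quadForm ds x)))

square-zero⊎pos : ∀ q → q ≡ 0ℚ ⊎ Positive (q ℚ.* q)
square-zero⊎pos q with ℚP.<-cmp q 0ℚ
... | tri< q<0 _ _ = inj₂ (ℚP.neg*neg⇒pos q {{ℚ.negative q<0}} q {{ℚ.negative q<0}})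
... | tri≈ _ q≡0 _ = inj₁ q≡0
... | tri> _ _ q>0 = inj₂ (ℚP.pos*pos⇒pos q {{ℚ.positive q>0}} q {{ℚ.positive q>0}})

square-nonNeg : ∀ q → NonNegative (q ℚ.* q)
square-nonNeg q with square-zero⊎pos q
... | inj₁ refl = _
... | inj₂ q²>0 = ℚP.pos⇒nonNeg (q ℚ.* q) {{q²>0}}

quadForm-nonNeg : ∀ {n} (ds : Vec ℕ n) → All (0 <_) ds → ∀ s → NonNegative (quadForm ds s)
quadForm-nonNeg []       []           q       = square-nonNeg q
quadForm-nonNeg (d ∷ ds) (d>0 ∷ ds>0) (a , b) =
  ℚP.nonNeg+nonNeg⇒nonNeg (quadForm ds a) {{quadForm-nonNeg ds ds>0 a}} (ℕ→ℚ d ℚ.* quadForm ds b)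
    {{ℚP.nonNeg*nonNeg⇒nonNeg (ℕ→ℚ d) {{ℚP.pos⇒nonNeg (ℕ→ℚ d) {{ℕ→ℚ-pos d d>0}}}}
                              (quadForm ds b) {{quadForm-nonNeg ds ds>0 b}}}}

quadForm-zero⊎pos : ∀ {n} (ds : Vec ℕ n) → All (0 <_) ds →
  ∀ s → s ≡ zeroF ds ⊎ Positive (quadForm ds s)
quadForm-zero⊎pos []       []           q = square-zero⊎pos q
quadForm-zero⊎pos (d ∷ ds) (d>0 ∷ ds>0) (a , b)
  with quadForm-zero⊎pos ds ds>0 a | quadForm-zero⊎pos ds ds>0 b
... | inj₁ refl | inj₁ refl = inj₁ refl
... | inj₂ Qa>0 | _         =
  inj₂ (ℚP.pos+nonNeg⇒pos (quadForm ds a) {{Qa>0}} (ℕ→ℚ d ℚ.* quadForm ds b)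
    {{ℚP.nonNeg*nonNeg⇒nonNeg (ℕ→ℚ d) {{ℚP.pos⇒nonNeg (ℕ→ℚ d) {{ℕ→ℚ-pos d d>0}}}}
                              (quadForm ds b) {{quadForm-nonNeg ds ds>0 b}}}})
... | inj₁ _    | inj₂ Qb>0 =
  inj₂ (ℚP.nonNeg+pos⇒pos (quadForm ds a) {{quadForm-nonNeg ds ds>0 a}} (ℕ→ℚ d ℚ.* quadForm ds b)
    {{ℚP.pos*pos⇒pos (ℕ→ℚ d) {{ℕ→ℚ-pos d d>0}} (quadForm ds b) {{Qb>0}}}})

quadForm-zeroF : ∀ {n} (ds : Vec ℕ n) → quadForm ds (zeroF ds) ≡ 0ℚ
quadForm-zeroF []       = refl
quadForm-zeroF (d ∷ ds) rewrite quadForm-zeroF ds | ℚP.*-zeroʳ (ℕ→ℚ d) = refl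

normSq-zeroF : ∀ {n} (ds : Vec ℕ n) → normSq ds (zeroF ds) ≡ 0ℚ
normSq-zeroF {n} ds =
  trans (normSq≡2ⁿ*quadForm ds (zeroF ds))
        (trans (cong (ℕ→ℚ (2 ℕ.^ n) ℚ.*_) (quadForm-zeroF ds)) (ℚP.*-zeroʳ (ℕ→ℚ (2 ℕ.^ n))))

normSq-pos : ∀ {n} (ds : Vec ℕ n) → All (0 <_) ds → ∀ s → ¬ s ≡ zeroF ds → Positive (normSq ds s)
normSq-pos {n} ds ds>0 s s≢0 with quadForm-zero⊎pos ds ds>0 s
... | inj₁ s≡0  = ⊥-elim (s≢0 s≡0)
... | inj₂ Qs>0 =
  subst Positive (sym (normSq≡2ⁿ*quadForm ds s))
    (ℚP.pos*pos⇒pos (ℕ→ℚ (2 ℕ.^ n)) {{ℕ→ℚ-pos _ (ℕP.m^n>0 2 n)}} (quadForm ds s) {{Qs>0}})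

theorem1p3 : ∀ {n} (ds : Vec ℕ n) → 1 ≤ n →
    All (λ d → 0 < d) ds → All SquareFree ds → IsFieldF ds →
    (M : F ds → Set) → IsNonzeroFracIdeal ds M →
    (m : ℚ) → IsMinSq ds M m →
    ∀ s →
      (Shortest ds M m s →
        ∃ λ (x : Vec Bool n → ℚ) → dioLHS ds x ≡ m × fromCoords ds x ≡ s × M s)
      ×
      ((∃ λ (x : Vec Bool n → ℚ) → dioLHS ds x ≡ m × fromCoords ds x ≡ s × M s) →
        Shortest ds M m s)
theorem1p3 ds _ ds>0 _ _ M _ m ((s₀ , _ , s₀≢0 , ‖s₀‖²≡m) , _) s =
  shortest⇒solution , solution⇒shortest
  where
  Solution : Set
  Solution = ∃ λ x → dioLHS ds x ≡ m × fromCoords ds x ≡ s × M s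

  shortest⇒solution : Shortest ds M m s → Solution
  shortest⇒solution (s∈M , _ , ‖s‖²≡m) =
    coords ds s ,
    trans (sym (normSq-fromCoords ds (coords ds s)))
          (trans (cong (normSq ds) (fromCoords-coords ds s)) ‖s‖²≡m) ,
    fromCoords-coords ds s , s∈M

  m>0 : 0ℚ ℚ.< m
  m>0 = subst (0ℚ ℚ.<_) ‖s₀‖²≡m (ℚP.positive⁻¹ _ {{normSq-pos ds ds>0 s₀ s₀≢0}})

  solution⇒shortest : Solution → Shortest ds M m s
  solution⇒shortest (x , dio≡m , x↦s , s∈M) = s∈M , s≢0 , ‖s‖²≡m
    where
    ‖s‖²≡m : normSq ds s ≡ m
    ‖s‖²≡m = trans (cong (normSq ds) (sym x↦s)) (trans (normSq-fromCoords ds x) dio≡m)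
    s≢0 : ¬ s ≡ zeroF ds
    s≢0 s≡0 = ℚP.<-irrefl (sym m≡0) m>0
      where
      m≡0 : m ≡ 0ℚ
      m≡0 = trans (sym ‖s‖²≡m) (trans (cong (normSq ds) s≡0) (normSq-zeroF ds))
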